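{- Let $n \ge 2$ and $1 \leq a_1 \leq \cdots \leq a_n$ be integers with $a_1 + \cdots + a_{n-1} > 6$. Then $\left|\mathcal{F}_{\Delta}(K_{a_1, \ldots, a_n})\right| = \left|\mathcal{F}(K_{a_1, \ldots, a_n})\right|$.
   Context: All graphs are finite, undirected and simple, and are considered up to isomorphism. $K_{a_1,\ldots,a_n}$ is the complete multipartite graph with parts of sizes $a_1,\ldots,a_n$. A Triangle-Y ($\nabla Y$) move on a graph takes a 3-cycle with vertices $x,y,z$, deletes the edges $xy,yz,zx$, and adds a new vertex $v$ with edges $xv,yv,zv$. A Y-Triangle ($Y\nabla$) move is the inverse operation: for a vertex $v$ of degree three whose neighbours $x,y,z$ are pairwise non-adjacent, delete $v$ and add the edges $xy,yz,zx$. The family $\mathcal{F}(G)$ is the set of (isomorphism classes of) graphs obtained from $G$ by sequences of zero or more $\nabla Y$ and $Y\nabla$ moves. The family of descendants $\mathcal{F}_\Delta(G)$ is the set of (isomorphism classes of) graphs obtained from $G$ by sequences of zero or more $\nabla Y$ moves only (including $G$ itself). -}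

module Defs where

open import Data.Bool using (Bool; true; false; _∧_; _∨_; not)
open import Data.Bool.Properties using (∧-comm; ∧-zeroʳ; ∨-comm)
open import Data.Nat using (ℕ; zero; suc; _+_; _≡ᵇ_)
open import Data.Nat.ListAction using (sum)
open import Data.Fin using (Fin; zero; suc; splitAt; punchIn; _≟_)
open import Data.List using (List; []; _∷_)
open import Data.Sum using (inj₁; inj₂)
open import Data.Product using (Σ; _,_; proj₁)
open import Function.Bundles using (_↔_; Inverse)
open import Relation.Nullary.Decidable using (⌊_⌋; yes; no)
open import Relation.Binary.PropositionalEquality using (_≡_; refl; sym; cong; cong₂; _≢_)

record Graph : Set where
  constructor mkGraph
  field
    n      : ℕ
    adj    : Fin n → Fin n → Bool
    adj-sym    : ∀ i j → adj i j ≡ adj j i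
    adj-irrefl : ∀ i → adj i i ≡ false
open Graph public

record _≅_ (G H : Graph) : Set where
  field
    bij      : Fin (n G) ↔ Fin (n H)
    preserve : ∀ i j → adj G i j ≡ adj H (Inverse.to bij i) (Inverse.to bij j)

_==_ : ∀ {m} → Fin m → Fin m → Bool
a == b = ⌊ a ≟ b ⌋

==-sym : ∀ {m} (a b : Fin m) → (a == b) ≡ (b == a)
==-sym a b with a ≟ b | b ≟ a
... | yes _ | yes _ = refl
... | no _  | no _  = refl
... | yes p | no q  with q (sym p)
... | ()
==-sym a b | no q | yes p with q (sym p)
... | ()

==-refl : ∀ {m} (a : Fin m) → (a == a) ≡ true
==-refl a with a ≟ a
... | yes _ = refl
... | no q with q refl
... | ()

inT : ∀ {m} → Fin m → Fin m → Fin m → Fin m → Bool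
inT x y z w = (w == x) ∨ ((w == y) ∨ (w == z))

-- Triangle-Y move on the triangle {x,y,z}: delete the three edges
-- xy, yz, zx and add a new vertex (here: vertex zero; the old vertices
-- are suc i) adjacent to exactly x, y, z.

∇Yadj : (G : Graph) → Fin (n G) → Fin (n G) → Fin (n G)
      → Fin (suc (n G)) → Fin (suc (n G)) → Bool
∇Yadj G x y z zero    zero    = false
∇Yadj G x y z zero    (suc j) = inT x y z j
∇Yadj G x y z (suc i) zero    = inT x y z i
∇Yadj G x y z (suc i) (suc j) = adj G i j ∧ not (inT x y z i ∧ inT x y z j)

∇Y-sym : ∀ G x y z i j → ∇Yadj G x y z i j ≡ ∇Yadj G x y z j i
∇Y-sym G x y z zero zero = refl
∇Y-sym G x y z zero (suc j) = refl
∇Y-sym G x y z (suc i) zero = refl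
∇Y-sym G x y z (suc i) (suc j) =
  cong₂ _∧_ (adj-sym G i j) (cong not (∧-comm (inT x y z i) (inT x y z j)))

∇Y-irrefl : ∀ G x y z i → ∇Yadj G x y z i i ≡ false
∇Y-irrefl G x y z zero = refl
∇Y-irrefl G x y z (suc i) = cong (_∧ _) (adj-irrefl G i)

∇Y : (G : Graph) → Fin (n G) → Fin (n G) → Fin (n G) → Graph
∇Y G x y z = mkGraph (suc (n G)) (∇Yadj G x y z) (∇Y-sym G x y z) (∇Y-irrefl G x y z)

data ∇YStep (G H : Graph) : Set where
  ∇y : (x y z : Fin (n G))
     → adj G x y ≡ true → adj G y z ≡ true → adj G x z ≡ true
     → H ≅ ∇Y G x y z
     → ∇YStep G H

-- Y-Triangle move at a vertex v of degree 3 with pairwise non-adjacent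
-- neighbours x, y, z: delete v and add the edges xy, yz, zx.
-- The remaining vertices are indexed by Fin m via punchIn v.

YΔadj : ∀ {m} → (Fin (suc m) → Fin (suc m) → Bool)
      → (v x y z : Fin (suc m)) → Fin m → Fin m → Bool
YΔadj A v x y z i j =
  A (punchIn v i) (punchIn v j)
  ∨ (inT x y z (punchIn v i) ∧ (inT x y z (punchIn v j) ∧ not (punchIn v i == punchIn v j)))

YΔ-sym : ∀ {m} (A : Fin (suc m) → Fin (suc m) → Bool) → (∀ i j → A i j ≡ A j i)
       → ∀ v x y z i j → YΔadj A v x y z i j ≡ YΔadj A v x y z j i
YΔ-sym A s v x y z i j =
  cong₂ _∨_ (s (punchIn v i) (punchIn v j))
    (lem (inT x y z (punchIn v i)) (inT x y z (punchIn v j))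
         (cong not (==-sym (punchIn v i) (punchIn v j))))
  where
  lem : ∀ a b {c d} → c ≡ d → (a ∧ (b ∧ c)) ≡ (b ∧ (a ∧ d))
  lem false false refl = refl
  lem false true refl = refl
  lem true false refl = refl
  lem true true refl = refl

YΔ-irrefl : ∀ {m} (A : Fin (suc m) → Fin (suc m) → Bool) → (∀ i → A i i ≡ false)
          → ∀ v x y z i → YΔadj A v x y z i i ≡ false
YΔ-irrefl A ir v x y z i
  rewrite ir (punchIn v i) | ==-refl (punchIn v i) = lem (inT x y z (punchIn v i))
  where
  lem : ∀ a → (a ∧ (a ∧ false)) ≡ false
  lem false = refl
  lem true = refl

YΔ : ∀ {m} (A : Fin (suc m) → Fin (suc m) → Bool)
   → (∀ i j → A i j ≡ A j i) → (∀ i → A i i ≡ false)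
   → (v x y z : Fin (suc m)) → Graph
YΔ {m} A s ir v x y z = mkGraph m (YΔadj A v x y z) (YΔ-sym A s v x y z) (YΔ-irrefl A ir v x y z)

data YΔStep : Graph → Graph → Set where
  yΔ : ∀ {m A s ir H} (v x y z : Fin (suc m))
     → x ≢ y → y ≢ z → x ≢ z
     → (∀ w → A v w ≡ inT x y z w)            -- N(v) = {x,y,z}, so deg v = 3
     → A x y ≡ false → A y z ≡ false → A x z ≡ false
     → H ≅ YΔ A s ir v x y z
     → YΔStep (mkGraph (suc m) A s ir) H

data Star (R : Graph → Graph → Set) : Graph → Graph → Set where
  ε   : ∀ {G} → Star R G G
  _◅_ : ∀ {G H K} → R G H → Star R H K → Star R G K

data AnyMove (G H : Graph) : Set where
  byΔY : ∇YStep G H → AnyMove G H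
  byYΔ : YΔStep G H → AnyMove G H

InF : Graph → Graph → Set
InF G H = Star AnyMove G H

InFΔ : Graph → Graph → Set
InFΔ G H = Star ∇YStep G H

-- "Same number of isomorphism classes": a bijection between the sets of
-- isomorphism classes of graphs satisfying P and Q respectively.

record SameNumberOfIsoClasses (P Q : Graph → Set) : Set where
  field
    to     : Σ Graph P → Σ Graph Q
    to-cong : ∀ a b → proj₁ a ≅ proj₁ b → proj₁ (to a) ≅ proj₁ (to b)
    to-inj  : ∀ a b → proj₁ (to a) ≅ proj₁ (to b) → proj₁ a ≅ proj₁ b
    to-surj : ∀ (c : Σ Graph Q) → Σ (Σ Graph P) (λ a → proj₁ (to a) ≅ proj₁ c)

-- Complete multipartite graph K_{a_1,...,a_n}: vertices Fin (a_1+...+a_n),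
-- the first a_1 vertices form part 0, the next a_2 part 1, etc.

partOf : (as : List ℕ) → Fin (sum as) → ℕ
partOf []       ()
partOf (k ∷ as) i with splitAt k i
... | inj₁ _ = 0
... | inj₂ j = suc (partOf as j)

K : List ℕ → Graph
K as = mkGraph (sum as) (λ i j → not (partOf as i ≡ᵇ partOf as j))
  (λ i j → cong not (≡ᵇsym (partOf as i) (partOf as j)))
  (λ i → cong not (≡ᵇ-refl (partOf as i)))
  where
  ≡ᵇ-refl : ∀ a → (a ≡ᵇ a) ≡ true
  ≡ᵇ-refl zero = refl
  ≡ᵇ-refl (suc a) = ≡ᵇ-refl a
  ≡ᵇsym : ∀ a b → (a ≡ᵇ b) ≡ (b ≡ᵇ a)
  ≡ᵇsym zero zero = refl
  ≡ᵇsym zero (suc b) = refl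
  ≡ᵇsym (suc a) zero = refl
  ≡ᵇsym (suc a) (suc b) = ≡ᵇsym a b

sumButLast : List ℕ → ℕ
sumButLast []           = 0
sumButLast (x ∷ [])     = 0
sumButLast (x ∷ y ∷ as) = x + sumButLast (y ∷ as)

{-# OPTIONS --safe #-}
-- Every vertex of K_{a₁,…,aₙ} has degree at least a₁ + ⋯ + aₙ₋₁ ≥ 7, and for any graph G of
-- minimum degree ≥ 7 the two families coincide up to isomorphism. Invariant: every graph of 𝓕(G)
-- is isomorphic to G with ∇Y applied successively to a list T of triples of vertices of G, each a
-- triangle at the moment it is replaced. A ∇Y move keeps the invariant because the neighbours of
-- a new vertex are pairwise non-adjacent, so every triangle consists of vertices of G. A Y∇ move at
-- a new vertex deletes its triple from T. A Y∇ move at a vertex i of G is impossible: each triple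
-- through i removed two edges at i and added one new neighbour, so deg_G i is at most twice the
-- current degree 3.
module Submission where

open import Defs
open import Algebra.Bundles using (CommutativeMonoid)
open import Data.Bool using (Bool; true; false; _∧_; _∨_; not; if_then_else_)
open import Data.Bool.Properties
  using (∨-commutativeMonoid; not-injective; ∧-distribʳ-∨; ∧-conicalˡ; ∧-conicalʳ;
         ∨-zeroʳ; ∨-identityʳ; ∧-zeroʳ; ∧-identityʳ)
open import Data.Empty using (⊥; ⊥-elim)
open import Data.Fin using (Fin; zero; suc; _≟_; _↑ˡ_; _↑ʳ_; punchIn; punchOut)
open import Data.Fin.Properties
  using (suc-injective; ↑ʳ-injective; splitAt-↑ˡ; splitAt-↑ʳ;
         punchInᵢ≢i; punchIn-injective; punchIn-punchOut; punchOut-punchIn)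
open import Data.List using (List; []; _∷_; length)
open import Data.List.Relation.Unary.All using (All)
open import Data.List.Relation.Unary.Linked using (Linked; _∷_)
open import Data.Nat using (ℕ; zero; suc; _+_; _*_; _≤_; _<_; z≤n; s≤s; _≡ᵇ_)
open import Data.Nat.ListAction using (sum)
open import Data.Nat.Properties
  using (≤-trans; ≤-reflexive; <-irrefl; n≤1+n; m≤n⇒m≤1+n; m≤n*m; +-comm; +-suc; *-suc; *-distribˡ-+;
         +-mono-≤; +-monoˡ-≤; +-monoʳ-≤; *-monoʳ-≤; +-commutativeSemigroup; module ≤-Reasoning)
open import Data.Product using (Σ; _,_; _×_; proj₁)
open import Data.Sum using (_⊎_; inj₁; inj₂)
open import Data.Unit using (⊤; tt)
open import Data.Vec using (Vec; []; _∷_; lookup; removeAt)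
open import Data.Vec.Properties using (removeAt-punchOut)
open import Function using (_∘_; id)
open import Function.Bundles using (Inverse; mk↔ₛ′)
open import Function.Definitions using (Injective)
open import Relation.Nullary using (yes; no)
open import Relation.Binary.PropositionalEquality

open import Algebra.Properties.CommutativeSemigroup +-commutativeSemigroup
  using () renaming (x∙yz≈y∙xz to +-swapˡ)
open import Algebra.Properties.CommutativeSemigroup (CommutativeMonoid.commutativeSemigroup ∨-commutativeMonoid)
  using () renaming (x∙yz≈y∙xz to ∨-swapˡ)

==⇒≡ : ∀ {m} {a b : Fin m} → (a == b) ≡ true → a ≡ b
==⇒≡ {a = a} {b} eq with a ≟ b
... | yes a≡b = a≡b

≡⇒== : ∀ {m} {a b : Fin m} → a ≡ b → (a == b) ≡ true
≡⇒== {a = a} refl = ==-refl a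

≢⇒== : ∀ {m} {a b : Fin m} → a ≢ b → (a == b) ≡ false
≢⇒== {a = a} {b} a≢b with a ≟ b
... | yes a≡b = ⊥-elim (a≢b a≡b)
... | no _ = refl

==-injective : ∀ {m m′} {f : Fin m → Fin m′} → Injective _≡_ _≡_ f
             → ∀ a b → (f a == f b) ≡ (a == b)
==-injective f-inj a b with a ≟ b
... | yes refl = ==-refl _
... | no a≢b = ≢⇒== (a≢b ∘ f-inj)

inT-injective : ∀ {m m′} {f : Fin m → Fin m′} → Injective _≡_ _≡_ f
              → ∀ x y z w → inT (f x) (f y) (f z) (f w) ≡ inT x y z w
inT-injective f-inj x y z w
  rewrite ==-injective f-inj w x | ==-injective f-inj w y | ==-injective f-inj w z = refl

inT⇒∈ : ∀ {m} (x y z w : Fin m) → inT x y z w ≡ true → w ≡ x ⊎ w ≡ y ⊎ w ≡ z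
inT⇒∈ x y z w eq with w ≟ x | w ≟ y | w ≟ z
... | yes w≡x | _       | _       = inj₁ w≡x
... | no _    | yes w≡y | _       = inj₂ (inj₁ w≡y)
... | no _    | no _    | yes w≡z = inj₂ (inj₂ w≡z)

count : ∀ {m} → (Fin m → Bool) → ℕ
count {zero}  f = 0
count {suc m} f = if f zero then suc (count (f ∘ suc)) else count (f ∘ suc)

count-cong : ∀ {m} {f g : Fin m → Bool} → (∀ j → f j ≡ g j) → count f ≡ count g
count-cong {zero}  f≗g = refl
count-cong {suc m} {f} {g} f≗g rewrite f≗g zero with g zero
... | true  = cong suc (count-cong (f≗g ∘ suc))
... | false = count-cong (f≗g ∘ suc)

count-mono : ∀ {m} {f g : Fin m → Bool} → (∀ j → f j ≡ true → g j ≡ true) → count f ≤ count g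
count-mono {zero} f⇒g = z≤n
count-mono {suc m} {f} {g} f⇒g with f zero in f₀ | g zero in g₀
... | true  | true  = s≤s (count-mono (f⇒g ∘ suc))
... | true  | false with () ← trans (sym (f⇒g zero f₀)) g₀
... | false | true  = m≤n⇒m≤1+n (count-mono (f⇒g ∘ suc))
... | false | false = count-mono (f⇒g ∘ suc)

count-∨ : ∀ {m} (f g : Fin m → Bool) → count (λ j → f j ∨ g j) ≤ count f + count g
count-∨ {zero}  f g = z≤n
count-∨ {suc m} f g with f zero | g zero
... | true  | true  = s≤s (≤-trans (count-∨ (f ∘ suc) (g ∘ suc)) (+-monoʳ-≤ (count (f ∘ suc)) (n≤1+n _)))
... | true  | false = s≤s (count-∨ (f ∘ suc) (g ∘ suc))
... | false | true  = ≤-trans (s≤s (count-∨ (f ∘ suc) (g ∘ suc))) (≤-reflexive (sym (+-suc _ _)))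
... | false | false = count-∨ (f ∘ suc) (g ∘ suc)

count-const : ∀ {m} (f : Fin m → Bool) → (∀ j → f j ≡ false) → count f ≡ 0
count-const {zero}  f f≗false = refl
count-const {suc m} f f≗false rewrite f≗false zero = count-const (f ∘ suc) (f≗false ∘ suc)

count-full : ∀ {m} (f : Fin m → Bool) → (∀ j → f j ≡ true) → count f ≡ m
count-full {zero}  f f≗true = refl
count-full {suc m} f f≗true rewrite f≗true zero = cong suc (count-full (f ∘ suc) (f≗true ∘ suc))

count-== : ∀ {m} (s : Fin m) → count (_== s) ≤ 1
count-== {suc m} zero    = s≤s (≤-reflexive (count-const {m} (λ j → suc j == zero) (λ _ → refl)))
count-== {suc m} (suc s) =
  ≤-trans (count-mono {f = λ j → suc j == suc s} (λ j e → ≡⇒== (suc-injective (==⇒≡ e)))) (count-== s)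

count-↑ : ∀ k n (f : Fin (k + n) → Bool) → count f ≡ count (f ∘ (_↑ˡ n)) + count (f ∘ (k ↑ʳ_))
count-↑ zero    n f = refl
count-↑ (suc k) n f rewrite count-↑ k n (f ∘ suc) with f zero
... | true  = refl
... | false = refl

count-pair : ∀ {m} (s t : Fin m) → count (λ j → (j == s) ∨ (j == t)) ≤ 2
count-pair s t = ≤-trans (count-∨ (_== s) (_== t)) (+-mono-≤ (count-== s) (count-== t))

count-inT : ∀ {m} (x y z : Fin m) → count (inT x y z) ≤ 3
count-inT x y z =
  ≤-trans (count-∨ (_== x) (λ w → (w == y) ∨ (w == z))) (+-mono-≤ (count-== x) (count-pair y z))

count-inT-without : ∀ {m} {x y z i : Fin m} → inT x y z i ≡ true
                  → count (λ j → inT x y z j ∧ not (j == i)) ≤ 2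
count-inT-without {x = x} {y} {z} {i} i∈ with inT⇒∈ x y z i i∈
... | inj₁ refl        = ≤-trans (count-mono λ j → drop₁ (j == x) (j == y) (j == z)) (count-pair y z)
  where
  drop₁ : ∀ a b c → (a ∨ (b ∨ c)) ∧ not a ≡ true → b ∨ c ≡ true
  drop₁ false b c e = trans (sym (∧-identityʳ _)) e
... | inj₂ (inj₁ refl) = ≤-trans (count-mono λ j → drop₂ (j == x) (j == y) (j == z)) (count-pair x z)
  where
  drop₂ : ∀ a b c → (a ∨ (b ∨ c)) ∧ not b ≡ true → a ∨ c ≡ true
  drop₂ true  false c e = refl
  drop₂ false false c e = trans (sym (∧-identityʳ _)) e
... | inj₂ (inj₂ refl) = ≤-trans (count-mono λ j → drop₃ (j == x) (j == y) (j == z)) (count-pair x y)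
  where
  drop₃ : ∀ a b c → (a ∨ (b ∨ c)) ∧ not c ≡ true → a ∨ b ≡ true
  drop₃ true  b     false e = refl
  drop₃ false true  false e = refl
  drop₃ false true  true  ()
  drop₃ false false true  ()

module _ {G H : Graph} (e : G ≅ H) where
  open _≅_ e

  ≅-to : Fin (n G) → Fin (n H)
  ≅-to = Inverse.to bij

  ≅-from : Fin (n H) → Fin (n G)
  ≅-from = Inverse.from bij

  ≅-to-from : ∀ v → ≅-to (≅-from v) ≡ v
  ≅-to-from = Inverse.strictlyInverseˡ bij

  ≅-from-to : ∀ v → ≅-from (≅-to v) ≡ v
  ≅-from-to = Inverse.strictlyInverseʳ bij

  ≅-to-injective : Injective _≡_ _≡_ ≅-to
  ≅-to-injective {u} {v} eq = trans (sym (≅-from-to u)) (trans (cong ≅-from eq) (≅-from-to v))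

  ≅-adj-from : ∀ u v → adj H u v ≡ adj G (≅-from u) (≅-from v)
  ≅-adj-from u v = sym (trans (preserve (≅-from u) (≅-from v)) (cong₂ (adj H) (≅-to-from u) (≅-to-from v)))

  ≅-neighbourhood : ∀ {v x y z} → (∀ w → adj G v w ≡ inT x y z w)
                  → ∀ w → adj H (≅-to v) w ≡ inT (≅-to x) (≅-to y) (≅-to z) w
  ≅-neighbourhood {v} {x} {y} {z} N[v] w = begin
    adj H (≅-to v) w                                   ≡⟨ cong (adj H (≅-to v)) (sym (≅-to-from w)) ⟩
    adj H (≅-to v) (≅-to (≅-from w))                   ≡⟨ sym (preserve v (≅-from w)) ⟩
    adj G v (≅-from w)                                 ≡⟨ N[v] (≅-from w) ⟩
    inT x y z (≅-from w)                               ≡⟨ sym (inT-injective ≅-to-injective x y z (≅-from w)) ⟩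
    inT (≅-to x) (≅-to y) (≅-to z) (≅-to (≅-from w))   ≡⟨ cong (inT (≅-to x) (≅-to y) (≅-to z)) (≅-to-from w) ⟩
    inT (≅-to x) (≅-to y) (≅-to z) w                   ∎
    where open ≡-Reasoning

≅-refl : ∀ {G} → G ≅ G
≅-refl = record { bij = mk↔ₛ′ id id (λ _ → refl) (λ _ → refl) ; preserve = λ _ _ → refl }

≅-sym : ∀ {G H} → G ≅ H → H ≅ G
≅-sym e = record
  { bij = mk↔ₛ′ (≅-from e) (≅-to e) (≅-from-to e) (≅-to-from e)
  ; preserve = ≅-adj-from e
  }

≅-trans : ∀ {G H K} → G ≅ H → H ≅ K → G ≅ K
≅-trans e d = record
  { bij = mk↔ₛ′ (≅-to d ∘ ≅-to e) (≅-from e ∘ ≅-from d)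
      (λ v → trans (cong (≅-to d) (≅-to-from e _)) (≅-to-from d v))
      (λ v → trans (cong (≅-from e) (≅-from-to d _)) (≅-from-to e v))
  ; preserve = λ u v → trans (_≅_.preserve e u v) (_≅_.preserve d _ _)
  }

∇Y-resp-≅ : ∀ {G H} (e : G ≅ H) x y z → ∇Y G x y z ≅ ∇Y H (≅-to e x) (≅-to e y) (≅-to e z)
∇Y-resp-≅ {G} {H} e x y z = record { bij = mk↔ₛ′ to from to-from from-to ; preserve = preserve }
  where
  to : Fin (suc (n G)) → Fin (suc (n H))
  to zero    = zero
  to (suc v) = suc (≅-to e v)
  from : Fin (suc (n H)) → Fin (suc (n G))
  from zero    = zero
  from (suc v) = suc (≅-from e v)
  to-from : ∀ v → to (from v) ≡ v
  to-from zero    = refl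
  to-from (suc v) = cong suc (≅-to-from e v)
  from-to : ∀ v → from (to v) ≡ v
  from-to zero    = refl
  from-to (suc v) = cong suc (≅-from-to e v)
  inT-to : ∀ v → inT (≅-to e x) (≅-to e y) (≅-to e z) (≅-to e v) ≡ inT x y z v
  inT-to = inT-injective (≅-to-injective e) x y z
  preserve : ∀ u v → ∇Yadj G x y z u v ≡ ∇Yadj H (≅-to e x) (≅-to e y) (≅-to e z) (to u) (to v)
  preserve zero    zero    = refl
  preserve zero    (suc v) = sym (inT-to v)
  preserve (suc u) zero    = sym (inT-to u)
  preserve (suc u) (suc v) rewrite inT-to u | inT-to v = cong (_∧ _) (_≅_.preserve e u v)

YΔ-resp-≅ : ∀ {m m′ A A′ s s′ ir ir′} (e : mkGraph (suc m) A s ir ≅ mkGraph (suc m′) A′ s′ ir′) v x y z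
          → YΔ A s ir v x y z ≅ YΔ A′ s′ ir′ (≅-to e v) (≅-to e x) (≅-to e y) (≅-to e z)
YΔ-resp-≅ {m} {m′} {A} {A′} e v x y z = record { bij = mk↔ₛ′ to from to-from from-to ; preserve = preserve }
  where
  f = ≅-to e
  g = ≅-from e
  to : Fin m → Fin m′
  to u = punchOut {i = f v} (punchInᵢ≢i v u ∘ sym ∘ ≅-to-injective e)
  from : Fin m′ → Fin m
  from u = punchOut {i = v} (λ v≡ → punchInᵢ≢i (f v) u (sym (trans (cong f v≡) (≅-to-from e _))))
  punchIn-to : ∀ u → punchIn (f v) (to u) ≡ f (punchIn v u)
  punchIn-to u = punchIn-punchOut _
  punchIn-from : ∀ u → punchIn v (from u) ≡ g (punchIn (f v) u)
  punchIn-from u = punchIn-punchOut _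
  to-from : ∀ u → to (from u) ≡ u
  to-from u = punchIn-injective (f v) _ _
    (trans (punchIn-to (from u)) (trans (cong f (punchIn-from u)) (≅-to-from e _)))
  from-to : ∀ u → from (to u) ≡ u
  from-to u = punchIn-injective v _ _
    (trans (punchIn-from (to u)) (trans (cong g (punchIn-to u)) (≅-from-to e _)))
  preserve : ∀ u w → YΔadj A v x y z u w ≡ YΔadj A′ (f v) (f x) (f y) (f z) (to u) (to w)
  preserve u w rewrite punchIn-to u | punchIn-to w
    | inT-injective (≅-to-injective e) x y z (punchIn v u)
    | inT-injective (≅-to-injective e) x y z (punchIn v w)
    | ==-injective (≅-to-injective e) (punchIn v u) (punchIn v w)
    | _≅_.preserve e (punchIn v u) (punchIn v w) = refl

_◅◅_ : ∀ {R G H K} → Star R G H → Star R H K → Star R G K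
ε        ◅◅ t = t
(r ◅ s) ◅◅ t = r ◅ (s ◅◅ t)

Star-map : ∀ {R S} → (∀ {G H} → R G H → S G H) → ∀ {G H} → Star R G H → Star S G H
Star-map f ε       = ε
Star-map f (r ◅ s) = f r ◅ Star-map f s

degree : (G : Graph) → Fin (n G) → ℕ
degree G v = count (adj G v)

Triple : ℕ → Set
Triple N = Fin N × Fin N × Fin N

member : ∀ {N} → Triple N → Fin N → Bool
member (x , y , z) = inT x y z

module Expansion (G : Graph) where
  private
    N = n G

  -- ∇Y puts its new vertex at position zero, so after k moves the new vertices come first.
  old : ∀ k → Fin N → Fin (k + N)
  old k i = k ↑ʳ i

  new : ∀ {k} → Fin k → Fin (k + N)
  new p = p ↑ˡ N

  mutual
    ∇Y* : ∀ {k} → Vec (Triple N) k → Graph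
    ∇Y* {k} T = mkGraph (k + N) (adj* T) (adj*-sym T) (adj*-irrefl T)

    adj* : ∀ {k} → Vec (Triple N) k → Fin (k + N) → Fin (k + N) → Bool
    adj* []                        = adj G
    adj* {suc k} ((x , y , z) ∷ T) = ∇Yadj (∇Y* T) (old k x) (old k y) (old k z)

    adj*-sym : ∀ {k} (T : Vec (Triple N) k) u v → adj* T u v ≡ adj* T v u
    adj*-sym []                        = adj-sym G
    adj*-sym {suc k} ((x , y , z) ∷ T) = ∇Y-sym (∇Y* T) (old k x) (old k y) (old k z)

    adj*-irrefl : ∀ {k} (T : Vec (Triple N) k) u → adj* T u u ≡ false
    adj*-irrefl []                        = adj-irrefl G
    adj*-irrefl {suc k} ((x , y , z) ∷ T) = ∇Y-irrefl (∇Y* T) (old k x) (old k y) (old k z)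

  covered : ∀ {k} → Vec (Triple N) k → Fin N → Fin N → Bool
  covered []      i j = false
  covered (t ∷ T) i j = (member t i ∧ member t j) ∨ covered T i j

  Applicable : ∀ {k} → Vec (Triple N) k → Set
  Applicable [] = ⊤
  Applicable {suc k} ((x , y , z) ∷ T) =
    (adj* T (old k x) (old k y) ≡ true) × (adj* T (old k y) (old k z) ≡ true) ×
    (adj* T (old k x) (old k z) ≡ true) × Applicable T

  Neighbourhood : ∀ {k} → Vec (Triple N) k → Fin (k + N) → (a b c : Fin (k + N)) → Set
  Neighbourhood T u a b c = ∀ w → adj* T u w ≡ inT a b c w

  data OldOrNew {k} : Fin (k + N) → Set where
    isNew : (p : Fin k) → OldOrNew (new p)
    isOld : (i : Fin N) → OldOrNew (old k i)

  oldOrNew : ∀ k (u : Fin (k + N)) → OldOrNew u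
  oldOrNew zero    u       = isOld u
  oldOrNew (suc k) zero    = isNew zero
  oldOrNew (suc k) (suc u) with oldOrNew k u
  ... | isNew p = isNew (suc p)
  ... | isOld i = isOld i

  old⊎new : ∀ k (u : Fin (k + N)) → (Σ (Fin N) λ i → u ≡ old k i) ⊎ (Σ (Fin k) λ p → u ≡ new p)
  old⊎new k u with oldOrNew k u
  ... | isOld i = inj₁ (i , refl)
  ... | isNew p = inj₂ (p , refl)

  new≢old : ∀ {k} (p : Fin k) i → new p ≢ old k i
  new≢old (suc p) i eq = new≢old p i (suc-injective eq)

  inT-old : ∀ k x y z w → inT (old k x) (old k y) (old k z) (old k w) ≡ inT x y z w
  inT-old k = inT-injective (λ {a} {b} → ↑ʳ-injective k a b)

  inT-old-new : ∀ {k} x y z (p : Fin k) → inT (old k x) (old k y) (old k z) (new p) ≡ false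
  inT-old-new {k} x y z p
    rewrite ≢⇒== (new≢old p x) | ≢⇒== (new≢old p y) | ≢⇒== (new≢old p z) = refl

  adj*-old-old : ∀ {k} (T : Vec (Triple N) k) i j
               → adj* T (old k i) (old k j) ≡ adj G i j ∧ not (covered T i j)
  adj*-old-old []                        i j = sym (∧-identityʳ _)
  adj*-old-old {suc k} ((x , y , z) ∷ T) i j
    rewrite inT-old k x y z i | inT-old k x y z j | adj*-old-old T i j
    = lemma (adj G i j) (inT x y z i ∧ inT x y z j) (covered T i j)
    where
    lemma : ∀ a b c → (a ∧ not c) ∧ not b ≡ a ∧ not (b ∨ c)
    lemma false b     c     = refl
    lemma true  false false = refl
    lemma true  false true  = refl
    lemma true  true  c     = ∧-zeroʳ (not c)

  adj*-new-old : ∀ {k} (T : Vec (Triple N) k) p j → adj* T (new p) (old k j) ≡ member (lookup T p) j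
  adj*-new-old {suc k} ((x , y , z) ∷ T) zero    j = inT-old k x y z j
  adj*-new-old {suc k} ((x , y , z) ∷ T) (suc p) j
    rewrite inT-old-new x y z p | adj*-new-old T p j = ∧-identityʳ _

  adj*-new-new : ∀ {k} (T : Vec (Triple N) k) p q → adj* T (new p) (new q) ≡ false
  adj*-new-new {suc k} ((x , y , z) ∷ T) zero    zero    = refl
  adj*-new-new {suc k} ((x , y , z) ∷ T) zero    (suc q) = inT-old-new x y z q
  adj*-new-new {suc k} ((x , y , z) ∷ T) (suc p) zero    = inT-old-new x y z p
  adj*-new-new {suc k} ((x , y , z) ∷ T) (suc p) (suc q) rewrite adj*-new-new T p q = refl

  covered-by-member : ∀ {k} (T : Vec (Triple N) k) p {i j}
                    → member (lookup T p) i ≡ true → member (lookup T p) j ≡ true → covered T i j ≡ true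
  covered-by-member (t ∷ T) zero    i∈ j∈ rewrite i∈ | j∈ = refl
  covered-by-member (t ∷ T) (suc p) {i} {j} i∈ j∈ rewrite covered-by-member T p {i} {j} i∈ j∈ = ∨-zeroʳ _

  triple-edges-deleted : ∀ {k} (T : Vec (Triple N) k) p {i j}
                       → member (lookup T p) i ≡ true → member (lookup T p) j ≡ true
                       → adj* T (old k i) (old k j) ≡ false
  triple-edges-deleted T p {i} {j} i∈ j∈ = begin
    adj* T (old _ i) (old _ j)        ≡⟨ adj*-old-old T i j ⟩
    adj G i j ∧ not (covered T i j)   ≡⟨ cong (λ c → adj G i j ∧ not c) (covered-by-member T p i∈ j∈) ⟩
    adj G i j ∧ false                 ≡⟨ ∧-zeroʳ _ ⟩
    false                             ∎
    where open ≡-Reasoning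

  new-in-no-triangle : ∀ {k} (T : Vec (Triple N) k) p {w z}
                     → adj* T (new p) w ≡ true → adj* T w z ≡ true → adj* T (new p) z ≡ true → ⊥
  new-in-no-triangle {k} T p {w} {z} pw wz pz with oldOrNew k w | oldOrNew k z
  ... | isNew q | _       with () ← trans (sym (adj*-new-new T p q)) pw
  ... | isOld j | isNew r with () ← trans (sym (adj*-new-new T p r)) pz
  ... | isOld j | isOld l
    with () ← trans (sym (triple-edges-deleted T p (trans (sym (adj*-new-old T p j)) pw)
                                                   (trans (sym (adj*-new-old T p l)) pz))) wz

  triangle⇒old : ∀ {k} (T : Vec (Triple N) k) {u w z}
               → adj* T u w ≡ true → adj* T w z ≡ true → adj* T u z ≡ true → Σ (Fin N) λ i → u ≡ old k i
  triangle⇒old {k} T {u} uw wz uz with oldOrNew k u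
  ... | isOld i = i , refl
  ... | isNew p = ⊥-elim (new-in-no-triangle T p uw wz uz)

  covered-count : ∀ {k} (T : Vec (Triple N) k) i
                → count (λ j → covered T i j ∧ not (j == i)) ≤ 2 * count (λ p → member (lookup T p) i)
  covered-count []                i = ≤-reflexive (count-const {N} _ (λ _ → refl))
  covered-count ((x , y , z) ∷ T) i with inT x y z i in i∈t
  ... | false = covered-count T i
  ... | true  = begin
    count (λ j → (inT x y z j ∨ covered T i j) ∧ not (j == i))
      ≡⟨ count-cong (λ j → ∧-distribʳ-∨ (not (j == i)) (inT x y z j) (covered T i j)) ⟩
    count (λ j → (inT x y z j ∧ not (j == i)) ∨ (covered T i j ∧ not (j == i)))
      ≤⟨ count-∨ (λ j → inT x y z j ∧ not (j == i)) (λ j → covered T i j ∧ not (j == i)) ⟩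
    count (λ j → inT x y z j ∧ not (j == i)) + count (λ j → covered T i j ∧ not (j == i))
      ≤⟨ +-mono-≤ (count-inT-without {x = x} {y} {z} {i} i∈t) (covered-count T i) ⟩
    2 + 2 * count (λ p → member (lookup T p) i)
      ≡⟨ *-suc 2 _ ⟨
    2 * suc (count (λ p → member (lookup T p) i))
      ∎
    where open ≤-Reasoning

  degree-old : ∀ {k} (T : Vec (Triple N) k) i
             → degree (∇Y* T) (old k i)
             ≡ count (λ p → member (lookup T p) i) + count (λ j → adj G i j ∧ not (covered T i j))
  degree-old {k} T i = trans (count-↑ k N (adj* T (old k i)))
    (cong₂ _+_ (count-cong λ p → trans (adj*-sym T (old k i) (new p)) (adj*-new-old T p i))
               (count-cong (adj*-old-old T i)))

  degree≤2*degree-old : ∀ {k} (T : Vec (Triple N) k) i → degree G i ≤ 2 * degree (∇Y* T) (old k i)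
  degree≤2*degree-old {k} T i = begin
    degree G i
      ≤⟨ count-mono kept-or-covered ⟩
    count (λ j → (adj G i j ∧ not (covered T i j)) ∨ (covered T i j ∧ not (j == i)))
      ≤⟨ count-∨ (λ j → adj G i j ∧ not (covered T i j)) (λ j → covered T i j ∧ not (j == i)) ⟩
    kept + count (λ j → covered T i j ∧ not (j == i))
      ≤⟨ +-monoʳ-≤ kept (covered-count T i) ⟩
    kept + 2 * triples
      ≡⟨ +-comm kept _ ⟩
    2 * triples + kept
      ≤⟨ +-monoʳ-≤ (2 * triples) (m≤n*m kept 2) ⟩
    2 * triples + 2 * kept
      ≡⟨ *-distribˡ-+ 2 triples kept ⟨
    2 * (triples + kept)
      ≡⟨ cong (2 *_) (degree-old T i) ⟨
    2 * degree (∇Y* T) (old k i)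
      ∎
    where
    open ≤-Reasoning
    triples = count (λ p → member (lookup T p) i)
    kept    = count (λ j → adj G i j ∧ not (covered T i j))
    kept-or-covered : ∀ j → adj G i j ≡ true
                    → ((adj G i j ∧ not (covered T i j)) ∨ (covered T i j ∧ not (j == i))) ≡ true
    kept-or-covered j ij rewrite ij with covered T i j
    ... | false = refl
    ... | true  = cong not (≢⇒== j≢i)
      where
      j≢i : j ≢ i
      j≢i refl with () ← trans (sym (adj-irrefl G j)) ij

  head-edge : ∀ {k} {x y z} (T : Vec (Triple N) k) → Applicable ((x , y , z) ∷ T)
            → ∀ {i j} → i ≢ j → inT x y z i ≡ true → inT x y z j ≡ true → adj* T (old k i) (old k j) ≡ true
  head-edge {k} {x} {y} {z} T (xy , yz , xz , _) {i} {j} i≢j i∈ j∈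
    with inT⇒∈ x y z i i∈ | inT⇒∈ x y z j j∈
  ... | inj₁ refl        | inj₁ refl        = ⊥-elim (i≢j refl)
  ... | inj₁ refl        | inj₂ (inj₁ refl) = xy
  ... | inj₁ refl        | inj₂ (inj₂ refl) = xz
  ... | inj₂ (inj₁ refl) | inj₁ refl        = trans (adj*-sym T _ _) xy
  ... | inj₂ (inj₁ refl) | inj₂ (inj₁ refl) = ⊥-elim (i≢j refl)
  ... | inj₂ (inj₁ refl) | inj₂ (inj₂ refl) = yz
  ... | inj₂ (inj₂ refl) | inj₁ refl        = trans (adj*-sym T _ _) xz
  ... | inj₂ (inj₂ refl) | inj₂ (inj₁ refl) = trans (adj*-sym T _ _) yz
  ... | inj₂ (inj₂ refl) | inj₂ (inj₂ refl) = ⊥-elim (i≢j refl)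

  applied-edge : ∀ {k} (T : Vec (Triple N) k) → Applicable T → ∀ p {i j} → i ≢ j
               → member (lookup T p) i ≡ true → member (lookup T p) j ≡ true → adj G i j ≡ true
  applied-edge ((x , y , z) ∷ T) app zero {i} {j} i≢j i∈ j∈ =
    ∧-conicalˡ _ _ (trans (sym (adj*-old-old T i j)) (head-edge T app i≢j i∈ j∈))
  applied-edge (t ∷ T) (_ , _ , _ , app) (suc p) = applied-edge T app p

  head-uncovered : ∀ {k} {x y z} (T : Vec (Triple N) k) → Applicable ((x , y , z) ∷ T)
                 → ∀ {i j} → i ≢ j → inT x y z i ≡ true → inT x y z j ≡ true → covered T i j ≡ false
  head-uncovered T app {i} {j} i≢j i∈ j∈ =
    not-injective (∧-conicalʳ _ _ (trans (sym (adj*-old-old T i j)) (head-edge T app i≢j i∈ j∈)))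

  covered-removeAt : ∀ {k} (T : Vec (Triple N) (suc k)) p i j
                   → covered T i j ≡ (member (lookup T p) i ∧ member (lookup T p) j) ∨ covered (removeAt T p) i j
  covered-removeAt (t ∷ T)     zero    i j = refl
  covered-removeAt (t ∷ u ∷ T) (suc p) i j
    rewrite covered-removeAt (u ∷ T) p i j =
      ∨-swapˡ (member t i ∧ member t j) (member (lookup (u ∷ T) p) i ∧ member (lookup (u ∷ T) p) j)
              (covered (removeAt (u ∷ T) p) i j)

  removeAt-uncovered : ∀ {k} (T : Vec (Triple N) (suc k)) → Applicable T → ∀ p {i j} → i ≢ j
                     → member (lookup T p) i ≡ true → member (lookup T p) j ≡ true
                     → covered (removeAt T p) i j ≡ false
  removeAt-uncovered ((x , y , z) ∷ T) app zero i≢j i∈ j∈ = head-uncovered T app i≢j i∈ j∈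
  removeAt-uncovered ((x , y , z) ∷ u ∷ T) app@(_ , _ , _ , app′) (suc p) {i} {j} i≢j i∈ j∈
    rewrite removeAt-uncovered (u ∷ T) app′ p i≢j i∈ j∈
    with inT x y z i in i∈t | inT x y z j in j∈t
  ... | true  | true  with () ← trans (sym (head-uncovered (u ∷ T) app i≢j i∈t j∈t))
                                      (covered-by-member (u ∷ T) p i∈ j∈)
  ... | true  | false = refl
  ... | false | _     = refl

  adj*-removeAt : ∀ {k} (T : Vec (Triple N) (suc k)) p {i j}
                → adj* T (old (suc k) i) (old (suc k) j) ≡ true → adj* (removeAt T p) (old k i) (old k j) ≡ true
  adj*-removeAt {k} T p {i} {j} ij = begin
    adj* (removeAt T p) (old k i) (old k j)            ≡⟨ adj*-old-old (removeAt T p) i j ⟩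
    adj G i j ∧ not (covered (removeAt T p) i j)       ≡⟨ weaken (adj G i j) _ _ still-edge ⟩
    true                                               ∎
    where
    open ≡-Reasoning
    still-edge : adj G i j ∧ not ((member (lookup T p) i ∧ member (lookup T p) j) ∨ covered (removeAt T p) i j) ≡ true
    still-edge = trans (cong (λ c → adj G i j ∧ not c) (sym (covered-removeAt T p i j)))
                       (trans (sym (adj*-old-old T i j)) ij)
    weaken : ∀ a b c → a ∧ not (b ∨ c) ≡ true → a ∧ not c ≡ true
    weaken true false false _ = refl

  Applicable-removeAt : ∀ {k} (T : Vec (Triple N) (suc k)) → Applicable T → ∀ p → Applicable (removeAt T p)
  Applicable-removeAt (t ∷ T) (_ , _ , _ , app) zero = app
  Applicable-removeAt (t ∷ u ∷ T) (xy , yz , xz , app) (suc p) =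
    adj*-removeAt (u ∷ T) p xy , adj*-removeAt (u ∷ T) p yz , adj*-removeAt (u ∷ T) p xz ,
    Applicable-removeAt (u ∷ T) app p

  lookup-removeAt : ∀ {k} (T : Vec (Triple N) (suc k)) p q → lookup (removeAt T p) q ≡ lookup T (punchIn p q)
  lookup-removeAt T p q =
    trans (cong (lookup (removeAt T p)) (sym (punchOut-punchIn p))) (removeAt-punchOut T (punchInᵢ≢i p q ∘ sym))

  punchIn-new : ∀ {k} (p : Fin (suc k)) q → punchIn (new p) (new q) ≡ new (punchIn p q)
  punchIn-new zero    q       = refl
  punchIn-new (suc p) zero    = refl
  punchIn-new (suc p) (suc q) = cong suc (punchIn-new p q)

  punchIn-old : ∀ {k} (p : Fin (suc k)) i → punchIn (new p) (old k i) ≡ old (suc k) i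
  punchIn-old         zero    i = refl
  punchIn-old {suc k} (suc p) i = cong suc (punchIn-old p i)

  module Undo {k} (T : Vec (Triple N) (suc k)) (app : Applicable T) (p : Fin (suc k)) where
    private
      R = removeAt T p
      P = punchIn (new p)

    restored : Fin (k + N) → Fin (k + N) → Bool
    restored u w = adj* T (P u) (P w) ∨ (adj* T (new p) (P u) ∧ (adj* T (new p) (P w) ∧ not (P u == P w)))

    restored-new-new : ∀ q r → restored (new q) (new r) ≡ adj* R (new q) (new r)
    restored-new-new q r rewrite punchIn-new p q | punchIn-new p r
      | adj*-new-new T (punchIn p q) (punchIn p r) | adj*-new-new T p (punchIn p q) | adj*-new-new R q r = refl

    restored-new-old : ∀ q j → restored (new q) (old k j) ≡ adj* R (new q) (old k j)
    restored-new-old q j rewrite punchIn-new p q | punchIn-old p j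
      | adj*-new-old T (punchIn p q) j | adj*-new-new T p (punchIn p q) | adj*-new-old R q j | lookup-removeAt T p q
      = ∨-identityʳ _

    restored-old-new : ∀ j q → restored (old k j) (new q) ≡ adj* R (old k j) (new q)
    restored-old-new j q rewrite punchIn-new p q | punchIn-old p j
      | adj*-new-new T p (punchIn p q) | ∧-zeroʳ (adj* T (new p) (old (suc k) j))
      | adj*-sym T (old (suc k) j) (new (punchIn p q)) | adj*-sym R (old k j) (new q)
      | adj*-new-old T (punchIn p q) j | adj*-new-old R q j | lookup-removeAt T p q
      = ∨-identityʳ _

    restored-old-old : ∀ i j → restored (old k i) (old k j) ≡ adj* R (old k i) (old k j)
    restored-old-old i j rewrite punchIn-old p i | punchIn-old p j
      | adj*-new-old T p i | adj*-new-old T p j | adj*-old-old T i j | adj*-old-old R i j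
      | covered-removeAt T p i j | ==-injective (λ {u} {v} → ↑ʳ-injective (suc k) u v) i j
      = restore-edge (member (lookup T p) i) (member (lookup T p) j) refl refl
      where
      restore-edge : ∀ mi mj → member (lookup T p) i ≡ mi → member (lookup T p) j ≡ mj
                   → (adj G i j ∧ not ((mi ∧ mj) ∨ covered R i j)) ∨ (mi ∧ (mj ∧ not (i == j)))
                   ≡ adj G i j ∧ not (covered R i j)
      restore-edge false mj    _  _ = ∨-identityʳ _
      restore-edge true  false _  _ = ∨-identityʳ _
      restore-edge true  true  i∈ j∈ with i ≟ j
      ... | yes refl rewrite adj-irrefl G i = refl
      ... | no i≢j rewrite applied-edge T app p i≢j i∈ j∈ | removeAt-uncovered T app p i≢j i∈ j∈ = refl

    restored≡adj*-removeAt : ∀ u w → restored u w ≡ adj* R u w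
    restored≡adj*-removeAt u w with oldOrNew k u | oldOrNew k w
    ... | isNew q | isNew r = restored-new-new q r
    ... | isNew q | isOld j = restored-new-old q j
    ... | isOld j | isNew q = restored-old-new j q
    ... | isOld i | isOld j = restored-old-old i j

  YΔ-new≅removeAt : ∀ {k} (T : Vec (Triple N) (suc k)) → Applicable T → ∀ p {a b c}
                  → Neighbourhood T (new p) a b c
                  → YΔ (adj* T) (adj*-sym T) (adj*-irrefl T) (new p) a b c ≅ ∇Y* (removeAt T p)
  YΔ-new≅removeAt T app p {a} {b} {c} N[p] =
    record { bij = mk↔ₛ′ id id (λ _ → refl) (λ _ → refl) ; preserve = preserve }
    where
    open Undo T app p
    preserve : ∀ u w → YΔadj (adj* T) (new p) a b c u w ≡ adj* (removeAt T p) u w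
    preserve u w rewrite sym (N[p] (punchIn (new p) u)) | sym (N[p] (punchIn (new p) w)) =
      restored≡adj*-removeAt u w

  Applicable⇒InFΔ : ∀ {k} (T : Vec (Triple N) k) → Applicable T → InFΔ G (∇Y* T)
  Applicable⇒InFΔ []                        _                    = ε
  Applicable⇒InFΔ {suc k} ((x , y , z) ∷ T) (xy , yz , xz , app) =
    Applicable⇒InFΔ T app ◅◅ (∇y (old k x) (old k y) (old k z) xy yz xz ≅-refl ◅ ε)

module Reachable (G : Graph) (δ≥7 : ∀ i → 7 ≤ degree G i) where
  open Expansion G

  Expanded : Graph → Set
  Expanded H = Σ ℕ λ k → Σ (Vec (Triple (n G)) k) λ T → Applicable T × H ≅ ∇Y* T

  old-vertex-not-cubic : ∀ {k} (T : Vec (Triple (n G)) k) i {a b c} → Neighbourhood T (old k i) a b c → ⊥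
  old-vertex-not-cubic T i {a} {b} {c} N[i] = <-irrefl refl (begin
    7                            ≤⟨ δ≥7 i ⟩
    degree G i                   ≤⟨ degree≤2*degree-old T i ⟩
    2 * degree (∇Y* T) (old _ i) ≡⟨ cong (2 *_) (count-cong N[i]) ⟩
    2 * count (inT a b c)        ≤⟨ *-monoʳ-≤ 2 (count-inT a b c) ⟩
    6                            ∎)
    where open ≤-Reasoning

  ∇Y-preserves-Expanded : ∀ {H H′} → Expanded H → ∇YStep H H′ → Expanded H′
  ∇Y-preserves-Expanded {H} (k , T , app , e) (∇y x y z xy yz xz H′≅) =
    extend (transport xy) (transport yz) (transport xz) (≅-trans H′≅ (∇Y-resp-≅ e x y z))
    where
    transport : ∀ {u w} → adj H u w ≡ true → adj* T (≅-to e u) (≅-to e w) ≡ true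
    transport {u} {w} uw = trans (sym (_≅_.preserve e u w)) uw
    extend : ∀ {u w z} → adj* T u w ≡ true → adj* T w z ≡ true → adj* T u z ≡ true
           → ∀ {H′} → H′ ≅ ∇Y (∇Y* T) u w z → Expanded H′
    extend {u} {w} {z} uw wz uz H′≅
      with triangle⇒old T uw wz uz
         | triangle⇒old T (trans (adj*-sym T w u) uw) uz wz
         | triangle⇒old T (trans (adj*-sym T z u) uz) uw (trans (adj*-sym T z w) wz)
    ... | i , refl | j , refl | l , refl = suc k , (i , j , l) ∷ T , (uw , wz , uz , app) , H′≅

  remove-new : ∀ k (T : Vec (Triple (n G)) k) → Applicable T
             → ∀ {m A s ir} (e : mkGraph (suc m) A s ir ≅ ∇Y* T) {v x y z}
             → Neighbourhood T (≅-to e v) (≅-to e x) (≅-to e y) (≅-to e z) → ∀ p → ≅-to e v ≡ new p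
             → ∀ {H′} → H′ ≅ YΔ A s ir v x y z → Expanded H′
  remove-new (suc k) T app e {v} {x} {y} {z} N[v] p v↦p H′≅ =
    k , removeAt T p , Applicable-removeAt T app p , ≅-trans H′≅ (≅-trans (YΔ-resp-≅ e v x y z) undone)
    where
    undone : YΔ (adj* T) (adj*-sym T) (adj*-irrefl T) (≅-to e v) (≅-to e x) (≅-to e y) (≅-to e z)
           ≅ ∇Y* (removeAt T p)
    undone rewrite v↦p = YΔ-new≅removeAt T app p N[v]

  YΔ-preserves-Expanded : ∀ {H H′} → Expanded H → YΔStep H H′ → Expanded H′
  YΔ-preserves-Expanded (k , T , app , e) (yΔ v x y z _ _ _ N[v] _ _ _ H′≅)
    with old⊎new k (≅-to e v)
  ... | inj₁ (i , v↦i) = ⊥-elim (old-vertex-not-cubic T i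
          (subst (λ u → Neighbourhood T u (≅-to e x) (≅-to e y) (≅-to e z)) v↦i (≅-neighbourhood e N[v])))
  ... | inj₂ (p , v↦p) = remove-new k T app e (≅-neighbourhood e N[v]) p v↦p H′≅

  Expanded-closed : ∀ {H H′} → Expanded H → InF H H′ → Expanded H′
  Expanded-closed ex ε               = ex
  Expanded-closed ex (byΔY m ◅ rest) = Expanded-closed (∇Y-preserves-Expanded ex m) rest
  Expanded-closed ex (byYΔ m ◅ rest) = Expanded-closed (YΔ-preserves-Expanded ex m) rest

  sameNumber : SameNumberOfIsoClasses (InFΔ G) (InF G)
  sameNumber = record
    { to      = λ (H , H∈FΔ) → H , Star-map byΔY H∈FΔ
    ; to-cong = λ _ _ H≅H′ → H≅H′
    ; to-inj  = λ _ _ H≅H′ → H≅H′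
    ; to-surj = λ (H , H∈F) → realise (Expanded-closed (0 , [] , tt , ≅-refl) H∈F)
    }
    where
    realise : ∀ {H} → Expanded H → Σ (Σ Graph (InFΔ G)) λ H′ → proj₁ H′ ≅ H
    realise (k , T , app , H≅) = (∇Y* T , Applicable⇒InFΔ T app) , ≅-sym H≅

sumExcept : List ℕ → ℕ → ℕ
sumExcept []       q       = 0
sumExcept (a ∷ as) zero    = sum as
sumExcept (a ∷ as) (suc q) = a + sumExcept as q

partOf-↑ˡ : ∀ a as (j : Fin a) → partOf (a ∷ as) (j ↑ˡ sum as) ≡ 0
partOf-↑ˡ a as j rewrite splitAt-↑ˡ a j (sum as) = refl

partOf-↑ʳ : ∀ a as (j : Fin (sum as)) → partOf (a ∷ as) (a ↑ʳ j) ≡ suc (partOf as j)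
partOf-↑ʳ a as j rewrite splitAt-↑ʳ a (sum as) j = refl

count-outside-part : ∀ as q → count (λ j → not (q ≡ᵇ partOf as j)) ≡ sumExcept as q
count-outside-part []       q = refl
count-outside-part (a ∷ as) q = trans (count-↑ a (sum as) _) (split q)
  where
  outside : ℕ → Fin (sum (a ∷ as)) → Bool
  outside q j = not (q ≡ᵇ partOf (a ∷ as) j)
  split : ∀ q → count (outside q ∘ (_↑ˡ sum as)) + count (outside q ∘ (a ↑ʳ_)) ≡ sumExcept (a ∷ as) q
  split zero = cong₂ _+_
    (count-const _ λ j → cong (λ r → not (0 ≡ᵇ r)) (partOf-↑ˡ a as j))
    (count-full _ λ j → cong (λ r → not (0 ≡ᵇ r)) (partOf-↑ʳ a as j))
  split (suc q) = cong₂ _+_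
    (count-full _ λ j → cong (λ r → not (suc q ≡ᵇ r)) (partOf-↑ˡ a as j))
    (trans (count-cong λ j → cong (λ r → not (suc q ≡ᵇ r)) (partOf-↑ʳ a as j)) (count-outside-part as q))

sumButLast≤sum-tail : ∀ a b rest → Linked _≤_ (a ∷ b ∷ rest) → a + sumButLast (b ∷ rest) ≤ sum (b ∷ rest)
sumButLast≤sum-tail a b []      (a≤b ∷ _)       = +-monoˡ-≤ 0 a≤b
sumButLast≤sum-tail a b (c ∷ r) (a≤b ∷ b≤c ∷ l) = begin
  a + (b + sumButLast (c ∷ r))   ≡⟨ +-swapˡ a b _ ⟩
  b + (a + sumButLast (c ∷ r))   ≤⟨ +-monoʳ-≤ b (sumButLast≤sum-tail a c r (≤-trans a≤b b≤c ∷ l)) ⟩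
  b + sum (c ∷ r)                ∎
  where open ≤-Reasoning

sumButLast≤sumExcept : ∀ as q → Linked _≤_ as → sumButLast as ≤ sumExcept as q
sumButLast≤sumExcept []             q       _       = z≤n
sumButLast≤sumExcept (a ∷ [])       q       _       = z≤n
sumButLast≤sumExcept (a ∷ b ∷ rest) zero    l       = sumButLast≤sum-tail a b rest l
sumButLast≤sumExcept (a ∷ b ∷ rest) (suc q) (_ ∷ l) = +-monoʳ-≤ a (sumButLast≤sumExcept (b ∷ rest) q l)

K-degree : ∀ as → Linked _≤_ as → 6 < sumButLast as → ∀ i → 7 ≤ degree (K as) i
K-degree as sorted big i = begin
  7                          ≤⟨ big ⟩
  sumButLast as              ≤⟨ sumButLast≤sumExcept as (partOf as i) sorted ⟩
  sumExcept as (partOf as i) ≡⟨ count-outside-part as (partOf as i) ⟨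
  degree (K as) i            ∎
  where open ≤-Reasoning

mainTheorem12 : (as : List ℕ)
    → 2 ≤ length as
    → All (1 ≤_) as
    → Linked _≤_ as
    → 6 < sumButLast as
    → SameNumberOfIsoClasses (InFΔ (K as)) (InF (K as))
mainTheorem12 as _ _ sorted big = Reachable.sameNumber (K as) (K-degree as sorted big)
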